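{- For every integer $n\ge 2$, the triangular snake $S_{3,n}$ is neighborhood-prime.
   Context: A neighborhood-prime labeling of a simple graph $G$ with $N$ vertices is a bijection $f:V(G)\to\{1,\ldots,N\}$ such that for every vertex $v$ with $\deg(v)>1$, $\gcd\{f(u):u\in N(v)\}=1$, where $N(v)$ is the neighborhood of $v$; a graph admitting one is neighborhood-prime. The triangular snake $S_{3,n}$ consists of a path $u_1,\ldots,u_n$ together with new vertices $v_1,\ldots,v_{n-1}$, where $v_i$ is adjacent to exactly $u_i$ and $u_{i+1}$, so that there are $n-1$ triangles whose bases form the path. -}

module Defs where

open import Data.Nat using (ℕ; zero; suc; _+_; _∸_; _<_; _≤_; _<ᵇ_; _≡ᵇ_)
open import Data.Nat.GCD using (gcd)
open import Data.Bool using (Bool; true; false; _∧_; _∨_; T; not)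
open import Data.Fin using (Fin; toℕ)
open import Data.List using (List; filter; map; foldr; length; allFin)
open import Data.Product using (Σ; _×_)
open import Function.Bundles using (_⤖_; Bijection)
open import Relation.Binary.PropositionalEquality using (_≡_; refl)
open import Relation.Nullary.Decidable using (T?)
open import Data.Bool.Properties using (∨-comm; ∧-zeroʳ)

record SimpleGraph : Set where
  field
    N     : ℕ
    Adj   : Fin N → Fin N → Bool
    sym   : ∀ u v → Adj u v ≡ Adj v u
    irref : ∀ v → Adj v v ≡ false

open SimpleGraph public

nbhd : (G : SimpleGraph) → Fin (N G) → List (Fin (N G))
nbhd G v = filter (λ u → T? (Adj G v u)) (allFin (N G))

degree : (G : SimpleGraph) → Fin (N G) → ℕ
degree G v = length (nbhd G v)

-- gcd of a finite list of naturals (gcd of the empty list is 0).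
gcdList : List ℕ → ℕ
gcdList = foldr gcd 0

-- A labeling is a bijection V(G) → {1,…,N}; we represent it as a bijection
-- σ : Fin N ⤖ Fin N and use the label f(v) = 1 + toℕ (σ v).
label : {N : ℕ} → (Fin N ⤖ Fin N) → Fin N → ℕ
label σ v = suc (toℕ (Bijection.to σ v))

IsNeighborhoodPrimeLabeling : (G : SimpleGraph) → (Fin (N G) ⤖ Fin (N G)) → Set
IsNeighborhoodPrimeLabeling G σ =
  ∀ v → 1 < degree G v → gcdList (map (label σ) (nbhd G v)) ≡ 1

NeighborhoodPrime : SimpleGraph → Set
NeighborhoodPrime G = Σ (Fin (N G) ⤖ Fin (N G)) (IsNeighborhoodPrimeLabeling G)

-- Vertex with index a < n is u_{a+1} (path vertex);
-- vertex with index n + j (j ≤ n-2) is v_{j+1}, adjacent to u_{j+1}, u_{j+2},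
-- i.e. to indices j and j+1.
pathAdj : ℕ → ℕ → ℕ → Bool
pathAdj n a b = (a <ᵇ n) ∧ (b <ᵇ n) ∧ ((suc a ≡ᵇ b) ∨ (suc b ≡ᵇ a))

apexAdj : ℕ → ℕ → ℕ → Bool
apexAdj n a b = not (a <ᵇ n) ∧ (b <ᵇ n) ∧ (((a ∸ n) ≡ᵇ b) ∨ (suc (a ∸ n) ≡ᵇ b))

snakeAdjℕ : ℕ → ℕ → ℕ → Bool
snakeAdjℕ n a b = pathAdj n a b ∨ apexAdj n a b ∨ apexAdj n b a

mkAdj : (N : ℕ) → (ℕ → ℕ → Bool) → Fin N → Fin N → Bool
mkAdj N R u v = (R (toℕ u) (toℕ v) ∨ R (toℕ v) (toℕ u)) ∧ not (toℕ u ≡ᵇ toℕ v)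

≡ᵇ-sym : ∀ a b → (a ≡ᵇ b) ≡ (b ≡ᵇ a)
≡ᵇ-sym zero zero = refl
≡ᵇ-sym zero (suc b) = refl
≡ᵇ-sym (suc a) zero = refl
≡ᵇ-sym (suc a) (suc b) = ≡ᵇ-sym a b

≡ᵇ-refl : ∀ a → (a ≡ᵇ a) ≡ true
≡ᵇ-refl zero = refl
≡ᵇ-refl (suc a) = ≡ᵇ-refl a

mkAdj-sym : ∀ N R (u v : Fin N) → mkAdj N R u v ≡ mkAdj N R v u
mkAdj-sym N R u v rewrite ∨-comm (R (toℕ u) (toℕ v)) (R (toℕ v) (toℕ u)) | ≡ᵇ-sym (toℕ u) (toℕ v) = refl

mkAdj-irref : ∀ N R (v : Fin N) → mkAdj N R v v ≡ false
mkAdj-irref N R v rewrite ≡ᵇ-refl (toℕ v) = ∧-zeroʳ _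

TriangularSnake : ℕ → SimpleGraph
TriangularSnake n = record
  { N     = n + (n ∸ 1)
  ; Adj   = mkAdj (n + (n ∸ 1)) (snakeAdjℕ n)
  ; sym   = mkAdj-sym (n + (n ∸ 1)) (snakeAdjℕ n)
  ; irref = mkAdj-irref (n + (n ∸ 1)) (snakeAdjℕ n)
  }

-- Number u₁, …, u_n, v₁, …, v_{n−1} by 1, …, 2n−1 and swap the labels of u₁
-- and u₂.  Then every vertex has two neighbours with coprime labels: u₁ sees
-- u₂, labelled 1; an interior u_k sees v_{k−1} and v_k, labelled n+k−1 and
-- n+k; v_j sees u_j and u_{j+1}, labelled consecutively apart from the pairs
-- (2, 1) and (1, 3); and u_n sees u_{n−1} and v_{n−1}, labelled n−1 and
-- 2n−1 = 2(n−1) + 1, or 2 and 3 when n = 2.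
module Submission where

open import Defs hiding (sym)
open import Data.Bool using (T; not; _∧_; _∨_)
open import Data.Bool.Properties using (T-∧; T-∨; T-≡; T-not-≡; ¬-not)
open import Data.Fin using (Fin; zero; suc; toℕ; fromℕ<)
open import Data.Fin.Properties using (toℕ-fromℕ<; toℕ<n)
open import Data.List using (_∷_; map)
open import Data.List.Membership.Propositional using (_∈_)
open import Data.List.Membership.Propositional.Properties
  using (∈-map⁺; ∈-filter⁺; ∈-allFin)
open import Data.List.Relation.Unary.Any using (here; there)
open import Data.Nat as ℕ
  using (ℕ; zero; suc; _+_; _∸_; _<_; _≤_; _<ᵇ_; _≡ᵇ_; _<?_; z≤n; s≤s)
open import Data.Nat.Coprimality as Coprimality
  using (Coprime; 1-coprimeTo; coprime-+)
open import Data.Nat.Divisibility using (_∣_; ∣-trans)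
open import Data.Nat.GCD using (gcd[m,n]∣m; gcd[m,n]∣n)
open import Data.Nat.Properties
open import Data.Product using (_×_; _,_; proj₁; proj₂)
open import Data.Sum as Sum using (_⊎_; inj₁; inj₂)
open import Function.Bundles using (_⤖_; mk↔ₛ′; Equivalence)
open import Function.Properties.Inverse using (↔⇒⤖)
open import Relation.Binary.PropositionalEquality
open import Relation.Nullary using (yes; no)

gcdList-∣ : ∀ {x xs} → x ∈ xs → gcdList xs ∣ x
gcdList-∣ {xs = y ∷ _}  (here refl) = gcd[m,n]∣m y _
gcdList-∣ {xs = y ∷ ys} (there x∈) = ∣-trans (gcd[m,n]∣n y _) (gcdList-∣ x∈)

gcdList≡1 : ∀ {x y xs} → x ∈ xs → y ∈ xs → Coprime x y → gcdList xs ≡ 1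
gcdList≡1 x∈ y∈ coprime = coprime (gcdList-∣ x∈ , gcdList-∣ y∈)

∈-nbhd : ∀ G {v w} → T (Adj G v w) → w ∈ nbhd G v
∈-nbhd G {w = w} = ∈-filter⁺ _ (∈-allFin w)

coprime-neighbours⇒gcd≡1 : ∀ G σ {v w w′} → w ∈ nbhd G v → w′ ∈ nbhd G v →
                           Coprime (label σ w) (label σ w′) →
                           gcdList (map (label σ) (nbhd G v)) ≡ 1
coprime-neighbours⇒gcd≡1 G σ w∈ w′∈ =
  gcdList≡1 (∈-map⁺ (label σ) w∈) (∈-map⁺ (label σ) w′∈)

≢⇒T-not-≡ᵇ : ∀ {m n} → m ≢ n → T (not (m ≡ᵇ n))
≢⇒T-not-≡ᵇ {m} {n} m≢n = Equivalence.from T-not-≡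
  (¬-not (λ eq → m≢n (≡ᵇ⇒≡ m n (Equivalence.from T-≡ eq))))

n+j≮ᵇn : ∀ n j → T (not (n + j <ᵇ n))
n+j≮ᵇn zero    j = _
n+j≮ᵇn (suc n) j = n+j≮ᵇn n j

coprime-suc : ∀ n → Coprime n (suc n)
coprime-suc n =
  subst (Coprime n) (+-comm n 1) (Coprimality.sym (coprime-+ (1-coprimeTo n)))

coprime-2n+1 : ∀ n → Coprime n (n + suc n)
coprime-2n+1 n = Coprimality.sym (coprime-+ (Coprimality.sym (coprime-suc n)))

data SnakeEdge (n : ℕ) : ℕ → ℕ → Set where
  path       : ∀ {a} → suc a < n → SnakeEdge n a (suc a)
  apex-left  : ∀ {j} → suc j < n → SnakeEdge n (n + j) j
  apex-right : ∀ {j} → suc j < n → SnakeEdge n (n + j) (suc j)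

Adjacent : ℕ → ℕ → ℕ → Set
Adjacent n a b = SnakeEdge n a b ⊎ SnakeEdge n b a

module _ {n : ℕ} where

  private
    left : ∀ {x} y → T x → T (x ∨ y)
    left y p = Equivalence.from T-∨ (inj₁ p)

    right : ∀ x {y} → T y → T (x ∨ y)
    right x p = Equivalence.from T-∨ (inj₂ p)

    both : ∀ {x y} → T x → T y → T (x ∧ y)
    both p q = Equivalence.from T-∧ (p , q)

  pathAdj-suc : ∀ {a} → suc a < n → T (pathAdj n a (suc a))
  pathAdj-suc {a} 1+a<n = both (<⇒<ᵇ (<-trans (n<1+n a) 1+a<n))
    (both (<⇒<ᵇ 1+a<n) (left (suc (suc a) ≡ᵇ a) (≡⇒≡ᵇ (suc a) (suc a) refl)))

  apexAdj-+ : ∀ {j b} → b < n → j ≡ b ⊎ suc j ≡ b → T (apexAdj n (n + j) b)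
  apexAdj-+ {j} {b} b<n j≈b rewrite m+n∸m≡n n j =
    both (n+j≮ᵇn n j) (both (<⇒<ᵇ b<n)
      (Equivalence.from T-∨ (Sum.map (≡⇒≡ᵇ j b) (≡⇒≡ᵇ (suc j) b) j≈b)))

  SnakeEdge⇒snakeAdjℕ : ∀ {a b} → SnakeEdge n a b → T (snakeAdjℕ n a b)
  SnakeEdge⇒snakeAdjℕ (path {a} 1+a<n) =
    left (apexAdj n a (suc a) ∨ apexAdj n (suc a) a) (pathAdj-suc 1+a<n)
  SnakeEdge⇒snakeAdjℕ (apex-left {j} 1+j<n) = right (pathAdj n (n + j) j)
    (left (apexAdj n j (n + j)) (apexAdj-+ (<-trans (n<1+n j) 1+j<n) (inj₁ refl)))
  SnakeEdge⇒snakeAdjℕ (apex-right {j} 1+j<n) = right (pathAdj n (n + j) (suc j))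
    (left (apexAdj n (suc j) (n + j)) (apexAdj-+ 1+j<n (inj₂ refl)))

  path-bounded : ∀ {a} → a < n → a < n + (n ∸ 1)
  path-bounded a<n = <-≤-trans a<n (m≤m+n n (n ∸ 1))

  apex-bounded : ∀ {j} → suc j < n → n + j < n + (n ∸ 1)
  apex-bounded 1+j<n = +-monoʳ-< n (∸-monoˡ-< 1+j<n (s≤s z≤n))

  SnakeEdge-distinct : ∀ {a b} → SnakeEdge n a b → a ≢ b
  SnakeEdge-distinct (path {a} _)         = <⇒≢ (n<1+n a)
  SnakeEdge-distinct (apex-left {j} 1+j<n) =
    ≢-sym (<⇒≢ (<-≤-trans (<-trans (n<1+n j) 1+j<n) (m≤m+n n j)))
  SnakeEdge-distinct (apex-right {j} 1+j<n) =
    ≢-sym (<⇒≢ (<-≤-trans 1+j<n (m≤m+n n j)))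

  SnakeEdge-bounded : ∀ {a b} → SnakeEdge n a b → a < n + (n ∸ 1) × b < n + (n ∸ 1)
  SnakeEdge-bounded (path {a} 1+a<n) =
    path-bounded (<-trans (n<1+n a) 1+a<n) , path-bounded 1+a<n
  SnakeEdge-bounded (apex-left {j} 1+j<n) =
    apex-bounded 1+j<n , path-bounded (<-trans (n<1+n j) 1+j<n)
  SnakeEdge-bounded (apex-right {j} 1+j<n) = apex-bounded 1+j<n , path-bounded 1+j<n

  Adjacent-bounded : ∀ {a b} → Adjacent n a b → b < n + (n ∸ 1)
  Adjacent-bounded (inj₁ a—b) = proj₂ (SnakeEdge-bounded a—b)
  Adjacent-bounded (inj₂ b—a) = proj₁ (SnakeEdge-bounded b—a)

  Adjacent-distinct : ∀ {a b} → Adjacent n a b → a ≢ b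
  Adjacent-distinct (inj₁ a—b) = SnakeEdge-distinct a—b
  Adjacent-distinct (inj₂ b—a) = ≢-sym (SnakeEdge-distinct b—a)

  Adjacent⇒∈nbhd : ∀ {v w : Fin (n + (n ∸ 1))} → Adjacent n (toℕ v) (toℕ w) →
                   w ∈ nbhd (TriangularSnake n) v
  Adjacent⇒∈nbhd {v} {w} adj = ∈-nbhd (TriangularSnake n)
    (both (symmetric adj) (≢⇒T-not-≡ᵇ (Adjacent-distinct adj)))
    where
    symmetric : Adjacent n (toℕ v) (toℕ w) →
                T (snakeAdjℕ n (toℕ v) (toℕ w) ∨ snakeAdjℕ n (toℕ w) (toℕ v))
    symmetric (inj₁ v—w) = left _ (SnakeEdge⇒snakeAdjℕ v—w)
    symmetric (inj₂ w—v) = right (snakeAdjℕ n (toℕ v) (toℕ w)) (SnakeEdge⇒snakeAdjℕ w—v)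

  neighbour : ∀ (v : Fin (n + (n ∸ 1))) {b} → Adjacent n (toℕ v) b → Fin (n + (n ∸ 1))
  neighbour v adj = fromℕ< (Adjacent-bounded adj)

  toℕ-neighbour : ∀ v {b} (adj : Adjacent n (toℕ v) b) → toℕ (neighbour v adj) ≡ b
  toℕ-neighbour v adj = toℕ-fromℕ< (Adjacent-bounded adj)

  neighbour-∈ : ∀ v {b} (adj : Adjacent n (toℕ v) b) →
                neighbour v adj ∈ nbhd (TriangularSnake n) v
  neighbour-∈ v adj =
    Adjacent⇒∈nbhd (subst (Adjacent n (toℕ v)) (sym (toℕ-neighbour v adj)) adj)

swap01 : ∀ {k} → Fin (suc (suc k)) → Fin (suc (suc k))
swap01 zero          = suc zero
swap01 (suc zero)    = zero
swap01 (suc (suc i)) = suc (suc i)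

swap01-involutive : ∀ {k} (i : Fin (suc (suc k))) → swap01 (swap01 i) ≡ i
swap01-involutive zero          = refl
swap01-involutive (suc zero)    = refl
swap01-involutive (suc (suc i)) = refl

swap01-bijection : ∀ k → Fin (suc (suc k)) ⤖ Fin (suc (suc k))
swap01-bijection k = ↔⇒⤖ (mk↔ₛ′ swap01 swap01 swap01-involutive swap01-involutive)

snakeLabel : ℕ → ℕ
snakeLabel 0             = 2
snakeLabel 1             = 1
snakeLabel (suc (suc i)) = suc (suc (suc i))

label-swap01 : ∀ {k} (i : Fin (suc (suc k))) →
               label (swap01-bijection k) i ≡ snakeLabel (toℕ i)
label-swap01 zero          = refl
label-swap01 (suc zero)    = refl
label-swap01 (suc (suc i)) = refl

snakeLabel-coprime-suc : ∀ j → Coprime (snakeLabel j) (snakeLabel (suc j))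
snakeLabel-coprime-suc 0             = Coprimality.sym (1-coprimeTo 2)
snakeLabel-coprime-suc 1             = 1-coprimeTo 3
snakeLabel-coprime-suc (suc (suc i)) = coprime-suc (suc (suc (suc i)))

snakeLabel-coprime-last : ∀ m → Coprime (snakeLabel m) (snakeLabel (suc (suc m) + m))
snakeLabel-coprime-last 0               = coprime-suc 2
snakeLabel-coprime-last 1               = 1-coprimeTo 5
snakeLabel-coprime-last m@(suc (suc _)) =
  subst (Coprime (suc m)) 2m+3≡ (coprime-2n+1 (suc m))
  where
  2m+3≡ : suc m + suc (suc m) ≡ suc (suc (suc (m + m)))
  2m+3≡ = cong suc (trans (+-suc m (suc m)) (cong suc (+-suc m m)))

data CoprimeNeighbours (n i : ℕ) : Set where
  coprimeNeighbours : ∀ {b c} → Adjacent n i b → Adjacent n i c →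
                      Coprime (snakeLabel b) (snakeLabel c) → CoprimeNeighbours n i

module _ (m : ℕ) where

  private
    n : ℕ
    n = suc (suc m)

  path-coprimeNeighbours : ∀ {a} → a < n → CoprimeNeighbours n a
  path-coprimeNeighbours {zero} _ = coprimeNeighbours u₁—u₂ u₁—u₂ (1-coprimeTo 1)
    where u₁—u₂ = inj₁ (path (s≤s (s≤s z≤n)))
  path-coprimeNeighbours {suc a} 1+a<n
    with m≤n⇒m<n∨m≡n {a} {m} (ℕ.s≤s⁻¹ (ℕ.s≤s⁻¹ 1+a<n))
  ... | inj₁ a<m =
    coprimeNeighbours (inj₂ (apex-right 1+a<n)) (inj₂ (apex-left (s≤s (s≤s a<m))))
      (subst (Coprime _) (cong snakeLabel (sym (+-suc n a))) (snakeLabel-coprime-suc (n + a)))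
  ... | inj₂ refl = coprimeNeighbours (inj₂ (path 1+a<n)) (inj₂ (apex-right 1+a<n))
    (snakeLabel-coprime-last m)

  apex-coprimeNeighbours : ∀ {j} → j < suc m → CoprimeNeighbours n (n + j)
  apex-coprimeNeighbours j<1+m = coprimeNeighbours
    (inj₁ (apex-left (s≤s j<1+m))) (inj₁ (apex-right (s≤s j<1+m))) (snakeLabel-coprime-suc _)

  snake-coprimeNeighbours : ∀ {i} → i < n + (n ∸ 1) → CoprimeNeighbours n i
  snake-coprimeNeighbours {i} i<N with i <? n
  ... | yes i<n = path-coprimeNeighbours i<n
  ... | no  i≮n =
    subst (CoprimeNeighbours n) (m+[n∸m]≡n n≤i) (apex-coprimeNeighbours i∸n<1+m)
    where
    n≤i = ≮⇒≥ i≮n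
    i∸n<1+m : i ∸ n < suc m
    i∸n<1+m = subst (i ∸ n <_) (m+n∸m≡n n (suc m)) (∸-monoˡ-< i<N n≤i)

  snakeLabeling : Fin (n + (n ∸ 1)) ⤖ Fin (n + (n ∸ 1))
  snakeLabeling = swap01-bijection (m + suc m)

  snakeLabeling-gcd≡1 : ∀ (v : Fin (n + (n ∸ 1))) → CoprimeNeighbours n (toℕ v) →
                        gcdList (map (label snakeLabeling) (nbhd (TriangularSnake n) v)) ≡ 1
  snakeLabeling-gcd≡1 v (coprimeNeighbours b-adj c-adj coprime) =
    coprime-neighbours⇒gcd≡1 (TriangularSnake n) snakeLabeling {v}
      (neighbour-∈ {n} v b-adj) (neighbour-∈ {n} v c-adj)
      (subst₂ Coprime (labelled (toℕ-neighbour {n} v b-adj))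
                      (labelled (toℕ-neighbour {n} v c-adj)) coprime)
    where
    labelled : ∀ {u : Fin (n + (n ∸ 1))} {b} → toℕ u ≡ b →
               snakeLabel b ≡ label snakeLabeling u
    labelled {u} refl = sym (label-swap01 u)

mainTheorem2 : ∀ n → 2 ≤ n → NeighborhoodPrime (TriangularSnake n)
mainTheorem2 (suc (suc m)) (s≤s (s≤s z≤n)) =
  snakeLabeling m , λ v _ → snakeLabeling-gcd≡1 m v (snake-coprimeNeighbours m (toℕ<n v))
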